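{- In any strong AMD code with $m\ge 2$ sources, for every source $s$ one has $\hat\epsilon_s\ge\frac{1}{a_s}$, where $a_s=|A(s)|$.
   Context: Let $\mathcal{G}$ be a finite additive abelian group of order $n\ge2$ and $\mathcal{S}$ a set of $m$ sources. An AMD code consists of pairwise disjoint nonempty subsets $A(s)\subseteq\mathcal{G}$ ($s\in\mathcal{S}$) and a (possibly randomized) public encoding function $E$ mapping $s$ to some $g\in A(s)$ with probability $\Pr[E(s)=g]$. Strong security game for a source $s$: the source $s$ is given to the adversary, who then chooses $\Delta\in\mathcal{G}\setminus\{0\}$ by a (possibly randomized) strategy depending on $s$; then $g=E(s)$ is computed; the adversary wins iff $g+\Delta\in A(s')$ for some $s'\ne s$. $\hat\epsilon_s$ is the maximum winning probability over all strategies for source $s$. -}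

module Defs where

open import Level using (Level; suc; _⊔_)
open import Data.Nat as ℕ using (ℕ; zero) renaming (suc to sucℕ)
open import Data.Bool using (Bool; true; false; if_then_else_)
open import Data.Fin using (Fin) renaming (zero to fzero; suc to fsuc)
open import Data.Fin.Properties using (any?) renaming (_≟_ to _≟ᶠ_)
open import Data.Fin.Subset using (Subset; _∈_; _∉_; _∩_; Empty; Nonempty; ∣_∣)
open import Data.Fin.Subset.Properties using (_∈?_)
open import Data.Product using (Σ; ∃; _×_; _,_)
open import Relation.Nullary using (¬_; does)
open import Relation.Nullary.Decidable using (¬?; _×-dec_)
open import Relation.Binary.PropositionalEquality using (_≡_; _≢_)
open import Relation.Binary.Structures using (IsTotalOrder)
open import Algebra.Structures using (IsCommutativeRing; IsAbelianGroup)

-- Probabilities take values in an arbitrary ordered field (e.g. ℝ),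
-- with propositional equality.  The inverse is a total operation, only
-- constrained on nonzero elements.

record OrderedField (c ℓ : Level) : Set (suc (c ⊔ ℓ)) where
  infixl 6 _+_
  infixl 7 _*_
  infix 4 _≤_
  field
    Carrier : Set c
    _≤_     : Carrier → Carrier → Set ℓ
    _+_ _*_ : Carrier → Carrier → Carrier
    -_      : Carrier → Carrier
    _⁻¹     : Carrier → Carrier
    0# 1#   : Carrier
    isCommutativeRing : IsCommutativeRing _≡_ _+_ _*_ -_ 0# 1#
    isTotalOrder      : IsTotalOrder _≡_ _≤_
    0≢1     : 0# ≢ 1#
    ⁻¹-inverse : ∀ x → x ≢ 0# → x * (x ⁻¹) ≡ 1#
    +-monoˡ-≤  : ∀ {x y} z → x ≤ y → x + z ≤ y + z
    *-nonneg   : ∀ {x y} → 0# ≤ x → 0# ≤ y → 0# ≤ x * y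

-- A finite abelian group of order n, with carrier Fin n (every finite
-- abelian group of order n is isomorphic to one of this form).

record FinAbelianGroup (n : ℕ) : Set where
  infixl 6 _⊕_
  field
    _⊕_  : Fin n → Fin n → Fin n
    𝟘    : Fin n
    ⊝_   : Fin n → Fin n
    isAbelianGroup : IsAbelianGroup _≡_ _⊕_ 𝟘 ⊝_

module Prob {c ℓ : Level} (F : OrderedField c ℓ) where
  open OrderedField F

  Σᶠ : ∀ {n} → (Fin n → Carrier) → Carrier
  Σᶠ {zero}   f = 0#
  Σᶠ {sucℕ n} f = f fzero + Σᶠ (λ i → f (fsuc i))

  fromℕ : ℕ → Carrier
  fromℕ zero     = 0#
  fromℕ (sucℕ k) = 1# + fromℕ k

  record IsDistribution {n : ℕ} (p : Fin n → Carrier) : Set (c ⊔ ℓ) where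
    field
      nonneg : ∀ g → 0# ≤ p g
      total  : Σᶠ p ≡ 1#

  -- An AMD code over the group G (order n) with m sources:
  -- pairwise disjoint nonempty sets A(s) and a randomized encoding,
  -- Pr[E(s) = g] = enc s g, supported on A(s).
  record AMDCode {n : ℕ} (G : FinAbelianGroup n) (m : ℕ) : Set (c ⊔ ℓ) where
    field
      A        : Fin m → Subset n
      nonempty : ∀ s → Nonempty (A s)
      disjoint : ∀ s s' → s ≢ s' → Empty (A s ∩ A s')
      enc      : Fin m → Fin n → Carrier
      enc-dist : ∀ s → IsDistribution (enc s)
      enc-supp : ∀ s g → g ∉ A s → enc s g ≡ 0#

  module _ {n m : ℕ} {G : FinAbelianGroup n} (C : AMDCode G m) where
    open FinAbelianGroup G
    open AMDCode C

    inOthers : Fin m → Fin n → Bool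
    inOthers s h = does (any? (λ s' → ¬? (s' ≟ᶠ s) ×-dec (h ∈? A s')))

    record IsStrategy (q : Fin n → Carrier) : Set (c ⊔ ℓ) where
      field
        dist   : IsDistribution q
        zero-0 : q 𝟘 ≡ 0#

    winProb : Fin m → (Fin n → Carrier) → Carrier
    winProb s q =
      Σᶠ (λ Δ → q Δ * Σᶠ (λ g → enc s g *
                   (if inOthers s (g ⊕ Δ) then 1# else 0#)))

    a : Fin m → ℕ
    a s = ∣ A s ∣

-- Let h be a most likely encoding of s.  Since E(s) is supported on A(s),
-- 1 = Σ Pr[E(s) = g] ≤ a_s · Pr[E(s) = h], so Pr[E(s) = h] ≥ 1/a_s.  The
-- adversary picks another source s′ and some g ∈ A(s′) and always plays
-- Δ = g − h, which is nonzero because A(s) and A(s′) are disjoint; it wins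
-- at least whenever E(s) = h.
module Submission where

open import Defs
open import Level using (Level; 0ℓ)
open import Data.Nat using (ℕ; zero; suc; _≥_; s≤s)
open import Data.Fin using (Fin) renaming (zero to fzero; suc to fsuc)
open import Data.Fin.Properties using (_≟_; any?)
open import Data.Fin.Subset using (Subset; inside; outside; _∈_; _∉_; ∣_∣)
open import Data.Fin.Subset.Properties using (_∈?_; drop-there; x∈p∩q⁺)
open import Data.Bool using (Bool; true; false; if_then_else_)
open import Data.Vec using ([]; _∷_)
open import Function using (_∘_)
open import Data.Product using (∃; _×_; _,_; proj₁; proj₂)
open import Data.Sum using (inj₁; inj₂)
open import Data.Empty using (⊥-elim)
open import Relation.Nullary using (¬_; yes; no; does)
open import Relation.Nullary.Decidable using (dec-true; ¬?; _×-dec_)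
open import Relation.Binary.PropositionalEquality
open import Relation.Binary.Structures using (IsTotalOrder)
open import Algebra.Structures using (IsCommutativeRing)
open import Algebra.Bundles using (Ring; AbelianGroup)
import Algebra.Properties.Ring as RingProperties
import Algebra.Properties.AbelianGroup as AbelianGroupProperties

∃-≢ : ∀ {m} → m ≥ 2 → (i : Fin m) → ∃ λ j → j ≢ i
∃-≢ (s≤s (s≤s _)) fzero    = fsuc fzero , λ ()
∃-≢ (s≤s (s≤s _)) (fsuc _) = fzero , λ ()

module OrderedFieldProperties {c ℓ : Level} (F : OrderedField c ℓ) where
  open OrderedField F
  open Prob F
  module R = IsCommutativeRing isCommutativeRing
  open IsTotalOrder isTotalOrder public using (antisym; total)
    renaming ( refl to ≤-refl; trans to ≤-trans
             ; ≤-respˡ-≈ to ≤-respˡ-≡; ≤-respʳ-≈ to ≤-respʳ-≡ )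

  ring : Ring c c
  ring = record { isRing = R.isRing }

  open RingProperties ring using (-1*x≈-x; -‿involutive; -‿distribʳ-*)

  x≤0⇒0≤-x : ∀ {x} → x ≤ 0# → 0# ≤ - x
  x≤0⇒0≤-x {x} x≤0 =
    subst₂ _≤_ (R.-‿inverseʳ x) (R.+-identityˡ (- x)) (+-monoˡ-≤ (- x) x≤0)

  0≰-1 : ¬ (0# ≤ - 1#)
  0≰-1 0≤-1 = 0≢1 (antisym 0≤1 1≤0)
    where
    0≤1 : 0# ≤ 1#
    0≤1 = subst (0# ≤_) (trans (-1*x≈-x (- 1#)) (-‿involutive 1#))
                (*-nonneg 0≤-1 0≤-1)
    1≤0 : 1# ≤ 0#
    1≤0 = subst₂ _≤_ (R.+-identityˡ 1#) (R.-‿inverseˡ 1#) (+-monoˡ-≤ 1# 0≤-1)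

  0≤1 : 0# ≤ 1#
  0≤1 with total 0# 1#
  ... | inj₁ 0≤1 = 0≤1
  ... | inj₂ 1≤0 = ⊥-elim (0≰-1 (x≤0⇒0≤-x 1≤0))

  1≰0 : ¬ (1# ≤ 0#)
  1≰0 1≤0 = 0≢1 (antisym 0≤1 1≤0)

  +-mono-≤ : ∀ {x y u v} → x ≤ y → u ≤ v → x + u ≤ y + v
  +-mono-≤ {x} {y} {u} {v} x≤y u≤v = ≤-trans (+-monoˡ-≤ u x≤y)
    (subst₂ _≤_ (R.+-comm u y) (R.+-comm v y) (+-monoˡ-≤ y u≤v))

  *-monoˡ-≤ : ∀ {x y} z → 0# ≤ z → x ≤ y → x * z ≤ y * z
  *-monoˡ-≤ {x} {y} z 0≤z x≤y = subst₂ _≤_ (R.+-identityˡ (x * z)) [y-x]z+xz≡yz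
      (+-monoˡ-≤ (x * z) (*-nonneg 0≤y-x 0≤z))
    where
    open ≡-Reasoning
    0≤y-x : 0# ≤ y + - x
    0≤y-x = subst₂ _≤_ (R.-‿inverseʳ x) refl (+-monoˡ-≤ (- x) x≤y)
    [y-x]z+xz≡yz : (y + - x) * z + x * z ≡ y * z
    [y-x]z+xz≡yz = begin
      (y + - x) * z + x * z     ≡⟨ cong (_+ x * z) (R.distribʳ z y (- x)) ⟩
      y * z + - x * z + x * z   ≡⟨ R.+-assoc (y * z) (- x * z) (x * z) ⟩
      y * z + (- x * z + x * z) ≡⟨ cong (y * z +_) (R.distribʳ z (- x) x) ⟨
      y * z + (- x + x) * z     ≡⟨ cong (λ t → y * z + t * z) (R.-‿inverseˡ x) ⟩
      y * z + 0# * z            ≡⟨ cong (y * z +_) (R.zeroˡ z) ⟩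
      y * z + 0#                ≡⟨ R.+-identityʳ (y * z) ⟩
      y * z                     ∎

  0≤x⇒0≤x⁻¹ : ∀ {x} → 0# ≤ x → x ≢ 0# → 0# ≤ x ⁻¹
  0≤x⇒0≤x⁻¹ {x} 0≤x x≢0 with total 0# (x ⁻¹)
  ... | inj₁ 0≤x⁻¹ = 0≤x⁻¹
  ... | inj₂ x⁻¹≤0 = ⊥-elim (0≰-1 (subst (0# ≤_) x*-x⁻¹≡-1
                                          (*-nonneg 0≤x (x≤0⇒0≤-x x⁻¹≤0))))
    where
    x*-x⁻¹≡-1 : x * - (x ⁻¹) ≡ - 1#
    x*-x⁻¹≡-1 = trans (sym (-‿distribʳ-* x (x ⁻¹))) (cong -_ (⁻¹-inverse x x≢0))

  1≤x*y⇒y≢0 : ∀ {x y} → 1# ≤ x * y → y ≢ 0#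
  1≤x*y⇒y≢0 {x} 1≤xy refl = 1≰0 (subst (1# ≤_) (R.zeroʳ x) 1≤xy)

  1≤x*y⇒x⁻¹≤y : ∀ {x y} → 0# ≤ x → 1# ≤ x * y → x ⁻¹ ≤ y
  1≤x*y⇒x⁻¹≤y {x} {y} 0≤x 1≤xy = subst₂ _≤_ (R.*-identityˡ (x ⁻¹)) xyx⁻¹≡y
      (*-monoˡ-≤ (x ⁻¹) (0≤x⇒0≤x⁻¹ 0≤x x≢0) 1≤xy)
    where
    open ≡-Reasoning
    x≢0 : x ≢ 0#
    x≢0 = 1≤x*y⇒y≢0 (subst (1# ≤_) (R.*-comm x y) 1≤xy)
    xyx⁻¹≡y : x * y * x ⁻¹ ≡ y
    xyx⁻¹≡y = begin
      x * y * x ⁻¹   ≡⟨ cong (_* x ⁻¹) (R.*-comm x y) ⟩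
      y * x * x ⁻¹   ≡⟨ R.*-assoc y x (x ⁻¹) ⟩
      y * (x * x ⁻¹) ≡⟨ cong (y *_) (⁻¹-inverse x x≢0) ⟩
      y * 1#         ≡⟨ R.*-identityʳ y ⟩
      y              ∎

  fromℕ-nonneg : ∀ k → 0# ≤ fromℕ k
  fromℕ-nonneg zero    = ≤-refl
  fromℕ-nonneg (suc k) = ≤-respˡ-≡ (R.+-identityˡ 0#) (+-mono-≤ 0≤1 (fromℕ-nonneg k))

  Σᶠ-cong : ∀ {n} {f g : Fin n → Carrier} → (∀ i → f i ≡ g i) → Σᶠ f ≡ Σᶠ g
  Σᶠ-cong {zero}  f≗g = refl
  Σᶠ-cong {suc n} f≗g = cong₂ _+_ (f≗g fzero) (Σᶠ-cong (λ i → f≗g (fsuc i)))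

  Σᶠ-*ˡ : ∀ {n} x (f : Fin n → Carrier) → Σᶠ (λ i → x * f i) ≡ x * Σᶠ f
  Σᶠ-*ˡ {zero}  x f = sym (R.zeroʳ x)
  Σᶠ-*ˡ {suc n} x f = trans (cong (x * f fzero +_) (Σᶠ-*ˡ x (λ i → f (fsuc i))))
                            (sym (R.distribˡ x (f fzero) _))

  Σᶠ-nonneg : ∀ {n} {f : Fin n → Carrier} → (∀ i → 0# ≤ f i) → 0# ≤ Σᶠ f
  Σᶠ-nonneg {zero}  0≤f = ≤-refl
  Σᶠ-nonneg {suc n} 0≤f = ≤-respˡ-≡ (R.+-identityˡ 0#)
    (+-mono-≤ (0≤f fzero) (Σᶠ-nonneg (λ i → 0≤f (fsuc i))))

  f≤Σᶠf : ∀ {n} {f : Fin n → Carrier} → (∀ i → 0# ≤ f i) → ∀ i → f i ≤ Σᶠ f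
  f≤Σᶠf {suc n} {f} 0≤f fzero    = ≤-respˡ-≡ (R.+-identityʳ (f fzero))
    (+-mono-≤ ≤-refl (Σᶠ-nonneg (λ i → 0≤f (fsuc i))))
  f≤Σᶠf {suc n} {f} 0≤f (fsuc i) = ≤-respˡ-≡ (R.+-identityˡ (f (fsuc i)))
    (+-mono-≤ (0≤f fzero) (f≤Σᶠf (λ j → 0≤f (fsuc j)) i))

  Σᶠ-≤-size*bound : ∀ {n} (p : Subset n) {f : Fin n → Carrier} {M} →
    (∀ i → i ∉ p → f i ≡ 0#) → (∀ i → f i ≤ M) → Σᶠ f ≤ fromℕ ∣ p ∣ * M
  Σᶠ-≤-size*bound []            {M = M} _ _ = subst (0# ≤_) (sym (R.zeroˡ M)) ≤-refl
  Σᶠ-≤-size*bound (inside ∷ p)  {f} {M} supp f≤M =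
    ≤-respʳ-≡
        (trans (cong (_+ fromℕ ∣ p ∣ * M) (sym (R.*-identityˡ M))) (sym (R.distribʳ M 1# _)))
      (+-mono-≤ (f≤M fzero)
        (Σᶠ-≤-size*bound p (λ i i∉p → supp (fsuc i) (i∉p ∘ drop-there)) (f≤M ∘ fsuc)))
  Σᶠ-≤-size*bound (outside ∷ p) {f} supp f≤M =
    ≤-respˡ-≡
        (sym (trans (cong (_+ Σᶠ (f ∘ fsuc)) (supp fzero λ ())) (R.+-identityˡ _)))
      (Σᶠ-≤-size*bound p (λ i i∉p → supp (fsuc i) (i∉p ∘ drop-there)) (f≤M ∘ fsuc))

  pointMass : ∀ {n} → Fin n → Fin n → Carrier
  pointMass d i = if does (i ≟ d) then 1# else 0#

  pointMass-off : ∀ {n} {d i : Fin n} → i ≢ d → pointMass d i ≡ 0#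
  pointMass-off {d = d} {i} i≢d with i ≟ d
  ... | yes i≡d = ⊥-elim (i≢d i≡d)
  ... | no _    = refl

  Σᶠ-pointMass : ∀ {n} (d : Fin n) (f : Fin n → Carrier) →
    Σᶠ (λ i → pointMass d i * f i) ≡ f d
  Σᶠ-pointMass fzero f = begin
    1# * f fzero + Σᶠ (λ i → 0# * f (fsuc i))
      ≡⟨ cong₂ _+_ (R.*-identityˡ (f fzero)) (Σᶠ-*ˡ 0# (f ∘ fsuc)) ⟩
    f fzero + 0# * Σᶠ (f ∘ fsuc)
      ≡⟨ cong (f fzero +_) (R.zeroˡ (Σᶠ (f ∘ fsuc))) ⟩
    f fzero + 0#
      ≡⟨ R.+-identityʳ (f fzero) ⟩
    f fzero ∎
    where open ≡-Reasoning
  Σᶠ-pointMass (fsuc d) f = trans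
    (cong₂ _+_ (R.zeroˡ (f fzero)) (Σᶠ-pointMass d (f ∘ fsuc)))
    (R.+-identityˡ _)

  pointMass-isDistribution : ∀ {n} (d : Fin n) → IsDistribution (pointMass d)
  pointMass-isDistribution d = record
    { nonneg = nonneg
    ; total  = trans (Σᶠ-cong (λ i → sym (R.*-identityʳ (pointMass d i))))
                     (Σᶠ-pointMass d (λ _ → 1#))
    }
    where
    nonneg : ∀ i → 0# ≤ pointMass d i
    nonneg i with i ≟ d
    ... | yes _ = 0≤1
    ... | no _  = ≤-refl

  argmax : ∀ {k} (f : Fin (suc k) → Carrier) → ∃ λ h → ∀ i → f i ≤ f h
  argmax {zero}  f = fzero , λ { fzero → ≤-refl }
  argmax {suc k} f with argmax (f ∘ fsuc)
  ... | h , max with total (f fzero) (f (fsuc h))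
  ... | inj₁ f0≤fh = fsuc h , λ { fzero → f0≤fh ; (fsuc i) → max i }
  ... | inj₂ fh≤f0 = fzero  , λ { fzero → ≤-refl ; (fsuc i) → ≤-trans (max i) fh≤f0 }

module FinAbelianGroupProperties {n} (G : FinAbelianGroup n) where
  open FinAbelianGroup G

  abelianGroup : AbelianGroup 0ℓ 0ℓ
  abelianGroup = record { isAbelianGroup = isAbelianGroup }

  open AbelianGroup abelianGroup using (assoc)
  open AbelianGroupProperties abelianGroup using (xyx⁻¹≈y)
  open AbelianGroupProperties abelianGroup public using (x∙y⁻¹≈ε⇒x≈y)

  x⊕[y⊝x]≡y : ∀ x y → x ⊕ (y ⊕ ⊝ x) ≡ y
  x⊕[y⊝x]≡y x y = trans (sym (assoc x y (⊝ x))) (xyx⁻¹≈y x y)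

module StrongGame {c ℓ : Level} (F : OrderedField c ℓ)
                  {n m} {G : FinAbelianGroup n} (C : Prob.AMDCode F G m) where
  open OrderedField F
  open Prob F
  open OrderedFieldProperties F
  open FinAbelianGroup G
  open FinAbelianGroupProperties G
  open AMDCode C

  shiftWinProb : Fin m → Fin n → Carrier
  shiftWinProb s Δ = Σᶠ (λ g → enc s g * (if inOthers C s (g ⊕ Δ) then 1# else 0#))

  winProb-pointMass : ∀ s Δ → winProb C s (pointMass Δ) ≡ shiftWinProb s Δ
  winProb-pointMass s Δ = Σᶠ-pointMass Δ (shiftWinProb s)

  pointMass-isStrategy : ∀ {Δ} → Δ ≢ 𝟘 → IsStrategy C (pointMass Δ)
  pointMass-isStrategy {Δ} Δ≢𝟘 = record
    { dist   = pointMass-isDistribution Δ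
    ; zero-0 = pointMass-off (Δ≢𝟘 ∘ sym)
    }

  inOthers-true : ∀ {s s′ h} → s′ ≢ s → h ∈ A s′ → inOthers C s h ≡ true
  inOthers-true {s} {s′} {h} s′≢s h∈As′ =
    dec-true (any? λ t → ¬? (t ≟ s) ×-dec (h ∈? A t)) (s′ , s′≢s , h∈As′)

  enc≤shiftWinProb : ∀ {s s′ g} h → s′ ≢ s → g ∈ A s′ → enc s h ≤ shiftWinProb s (g ⊕ ⊝ h)
  enc≤shiftWinProb {s} {s′} {g} h s′≢s g∈As′ = ≤-respˡ-≡ hit (f≤Σᶠf 0≤term h)
    where
    indicator : Bool → Carrier
    indicator b = if b then 1# else 0#
    0≤term : ∀ x → 0# ≤ enc s x * indicator (inOthers C s (x ⊕ (g ⊕ ⊝ h)))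
    0≤term x with inOthers C s (x ⊕ (g ⊕ ⊝ h))
    ... | true  = *-nonneg (IsDistribution.nonneg (enc-dist s) x) 0≤1
    ... | false = *-nonneg (IsDistribution.nonneg (enc-dist s) x) ≤-refl
    hit : enc s h * indicator (inOthers C s (h ⊕ (g ⊕ ⊝ h))) ≡ enc s h
    hit = trans (cong (λ x → enc s h * indicator (inOthers C s x)) (x⊕[y⊝x]≡y h g))
                (trans (cong (λ b → enc s h * indicator b) (inOthers-true s′≢s g∈As′))
                       (R.*-identityʳ (enc s h)))

  1≤size*max : ∀ {s h} → (∀ g → enc s g ≤ enc s h) → 1# ≤ fromℕ (a C s) * enc s h
  1≤size*max {s} max =
    ≤-respˡ-≡ (IsDistribution.total (enc-dist s)) (Σᶠ-≤-size*bound (A s) (enc-supp s) max)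

  max∈A : ∀ {s h} → (∀ g → enc s g ≤ enc s h) → h ∈ A s
  max∈A {s} {h} max with h ∈? A s
  ... | yes h∈As = h∈As
  ... | no  h∉As = ⊥-elim (1≤x*y⇒y≢0 (1≤size*max max) (enc-supp s h h∉As))

  shift-≢𝟘 : ∀ {s s′ g h} → s′ ≢ s → h ∈ A s → g ∈ A s′ → g ⊕ ⊝ h ≢ 𝟘
  shift-≢𝟘 {s} {s′} {g} {h} s′≢s h∈As g∈As′ g⊝h≡𝟘 = disjoint s s′ (s′≢s ∘ sym)
    (h , x∈p∩q⁺ (h∈As , subst (_∈ A s′) (x∙y⁻¹≈ε⇒x≈y g h g⊝h≡𝟘) g∈As′))

mainTheorem14 : ∀ {c ℓ : Level} (F : OrderedField c ℓ) (n m : ℕ) → n ≥ 2 → m ≥ 2 →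
    (G : FinAbelianGroup n) (C : Prob.AMDCode F G m) (s : Fin m) →
    ∃ λ q → Prob.IsStrategy F C q ×
      OrderedField._≤_ F (OrderedField._⁻¹ F (Prob.fromℕ F (Prob.a F C s))) (Prob.winProb F C s q)
mainTheorem14 F (suc n) m (s≤s _) m≥2 G C s =
  pointMass Δ , pointMass-isStrategy (shift-≢𝟘 s′≢s (max∈A h-max) g∈As′) ,
  ≤-trans (1≤x*y⇒x⁻¹≤y (fromℕ-nonneg (a C s)) (1≤size*max h-max))
          (≤-respʳ-≡ (sym (winProb-pointMass s Δ)) (enc≤shiftWinProb h s′≢s g∈As′))
  where
  open OrderedField F using (_≤_)
  open FinAbelianGroup G
  open Prob F
  open AMDCode C
  open OrderedFieldProperties F
  open StrongGame F C
  h : Fin (suc n)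
  h = proj₁ (argmax (enc s))
  h-max : ∀ i → enc s i ≤ enc s h
  h-max = proj₂ (argmax (enc s))
  s′ : Fin m
  s′ = proj₁ (∃-≢ m≥2 s)
  s′≢s : s′ ≢ s
  s′≢s = proj₂ (∃-≢ m≥2 s)
  g : Fin (suc n)
  g = proj₁ (nonempty s′)
  g∈As′ : g ∈ A s′
  g∈As′ = proj₂ (nonempty s′)
  Δ : Fin (suc n)
  Δ = g ⊕ ⊝ h
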